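{- For any graph $G$ with no isolated vertex, order $n$ and maximum degree $\Delta$, $$\left\lceil\frac{2n}{\Delta+1}\right\rceil\le\gamma_{(2,1,0)}(G)\le\min\{\gamma_{\times2}(G)-|L(G)|+|S(G)|,\;2\gamma(G)\}.$$
   Context: All graphs are finite and simple; $N(v)$ is the open neighbourhood, $N[v]=N(v)\cup\{v\}$, and $f(S)=\sum_{u\in S}f(u)$. $\gamma_{(2,1,0)}(G)$ is the minimum of $\sum_v f(v)$ over functions $f:V(G)\to\{0,1,2\}$ such that $f(N(v))\ge2$ whenever $f(v)=0$ and $f(N(v))\ge1$ whenever $f(v)=1$. $\gamma(G)$ is the domination number; $\gamma_{\times2}(G)$ is the double domination number (minimum size of a set $D$ with $|N[v]\cap D|\ge2$ for every vertex $v$). $L(G)$ is the set of leaves (degree-one vertices) and $S(G)$ is the set of support vertices (vertices adjacent to a leaf). -}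

module Defs where

open import Data.Nat using (ℕ; zero; suc; _+_; _*_; _∸_; _≤_; _⊔_; _/_)
open import Data.Fin using (Fin; toℕ)
open import Data.Bool using (Bool; true; false; if_then_else_; _∧_)
open import Data.Product using (_×_; Σ; ∃)
open import Data.Vec.Functional using (foldr)
open import Relation.Binary.PropositionalEquality using (_≡_)
open import Relation.Nullary using (¬_)

record Graph (n : ℕ) : Set where
  field
    adj    : Fin n → Fin n → Bool
    sym    : ∀ u v → adj u v ≡ adj v u
    irrefl : ∀ v → adj v v ≡ false
open Graph public

Σᵥ : ∀ {n} → (Fin n → ℕ) → ℕ
Σᵥ g = foldr _+_ 0 g

count : ∀ {n} → (Fin n → Bool) → ℕ
count p = Σᵥ (λ v → if p v then 1 else 0)

anyV : ∀ {n} → (Fin n → Bool) → Bool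
anyV {n} p = foldr (λ b c → if b then true else c) false p

module _ {n : ℕ} (G : Graph n) where

  sumN : (Fin n → ℕ) → Fin n → ℕ
  sumN f v = Σᵥ (λ u → if adj G v u then f u else 0)

  deg : Fin n → ℕ
  deg v = count (adj G v)

  maxDeg : ℕ
  maxDeg = foldr _⊔_ 0 deg

  NoIsolated : Set
  NoIsolated = ∀ v → ¬ (deg v ≡ 0)

  isLeaf : Fin n → Bool
  isLeaf v with deg v
  ... | 1 = true
  ... | _ = false

  isSupport : Fin n → Bool
  isSupport v = anyV (λ u → adj G v u ∧ isLeaf u)

  numLeaves : ℕ
  numLeaves = count isLeaf

  numSupports : ℕ
  numSupports = count isSupport

  weight : (Fin n → ℕ) → ℕ
  weight f = Σᵥ f

  Is210DF : (Fin n → Fin 3) → Set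
  Is210DF f = ∀ v →
    (toℕ (f v) ≡ 0 → 2 ≤ sumN (λ u → toℕ (f u)) v) ×
    (toℕ (f v) ≡ 1 → 1 ≤ sumN (λ u → toℕ (f u)) v)

  χ : (Fin n → Bool) → Fin n → ℕ
  χ D v = if D v then 1 else 0

  closedNbhdCount : (Fin n → Bool) → Fin n → ℕ
  closedNbhdCount D v = χ D v + sumN (χ D) v

  IsDominating : (Fin n → Bool) → Set
  IsDominating D = ∀ v → 1 ≤ closedNbhdCount D v

  IsDoubleDominating : (Fin n → Bool) → Set
  IsDoubleDominating D = ∀ v → 2 ≤ closedNbhdCount D v

  Is210DomNumber : ℕ → Set
  Is210DomNumber m =
    (Σ (Fin n → Fin 3) λ f → Is210DF f × weight (λ v → toℕ (f v)) ≡ m) ×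
    (∀ f → Is210DF f → m ≤ weight (λ v → toℕ (f v)))

  IsDomNumber : ℕ → Set
  IsDomNumber m =
    (Σ (Fin n → Bool) λ D → IsDominating D × count D ≡ m) ×
    (∀ D → IsDominating D → m ≤ count D)

  IsDoubleDomNumber : ℕ → Set
  IsDoubleDomNumber m =
    (Σ (Fin n → Bool) λ D → IsDoubleDominating D × count D ≡ m) ×
    (∀ D → IsDoubleDominating D → m ≤ count D)

-- ⌈a / (b+1)⌉
ceilDivSuc : ℕ → ℕ → ℕ
ceilDivSuc a b = (a + b) / suc b

-- Under a (2,1,0)-dominating function f every closed neighbourhood has weight at least 2;
-- summing over all vertices counts f(u) once for u itself and deg u ≤ Δ times as a
-- neighbour, so 2n ≤ (Δ+1)·w(f). For the upper bounds, 2·χ_D is (2,1,0)-dominating for a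
-- dominating set D; and a double dominating set D contains every leaf and every support,
-- so the function that is 2 on supports, 0 on leaves and 1 on the rest of D is
-- (2,1,0)-dominating of weight |D| - |L| + |S|.
module Submission where

open import Defs hiding (sym)
open import Data.Nat using (ℕ; _≤_; _*_)
open import Data.Integer using (ℤ; +_; _-_; _⊓_) renaming (_+_ to _+ℤ_; _≤_ to _≤ℤ_)
open import Data.Product using (_×_)

open import Data.Nat using (zero; suc; _+_; _<_; _⊔_; z≤n; s≤s)
open import Data.Nat.Properties
open import Data.Nat.DivMod using (m<n*o⇒m/o<n)
open import Data.Fin using (Fin; toℕ; zero; suc)
open import Data.Fin.Patterns using (0F; 1F; 2F)
open import Data.Bool using (Bool; true; false; if_then_else_; _∧_)
open import Data.Bool.Properties using (if-float; if-cong; if-cong-then; if-cong-else; ¬-not)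
open import Data.Product using (∃; _,_)
open import Data.Sum using (_⊎_; inj₁; inj₂)
open import Data.Vec.Functional using (foldr)
open import Function using (_∘_; case_of_)
open import Relation.Binary.PropositionalEquality
  using (_≡_; refl; sym; trans; cong; cong₂; subst; module ≡-Reasoning)
open import Algebra.Properties.Semiring.Sum +-*-semiring
  using (sum-cong-≗; ∑-comm; ∑-distrib-+; *-distribˡ-sum; *-distribʳ-sum)
open import Data.Integer using (+≤+)
open import Data.Integer.Properties using (pos-+) renaming (⊓-glb to ℤ-⊓-glb)
open import Data.Integer.Tactic.RingSolver using (solve-∀)

Σᵥ-mono-≤ : ∀ {n} {f g : Fin n → ℕ} → (∀ v → f v ≤ g v) → Σᵥ f ≤ Σᵥ g
Σᵥ-mono-≤ {zero}  f≤g = z≤n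
Σᵥ-mono-≤ {suc n} f≤g = +-mono-≤ (f≤g zero) (Σᵥ-mono-≤ (f≤g ∘ suc))

Σᵥ-mono-< : ∀ {n} {f g : Fin n → ℕ} → (∀ v → f v ≤ g v) →
            ∀ v → f v < g v → Σᵥ f < Σᵥ g
Σᵥ-mono-< f≤g zero    fv<gv = +-mono-<-≤ fv<gv (Σᵥ-mono-≤ (f≤g ∘ suc))
Σᵥ-mono-< f≤g (suc v) fv<gv = +-mono-≤-< (f≤g zero) (Σᵥ-mono-< (f≤g ∘ suc) v fv<gv)

Σᵥ-const : ∀ n c → Σᵥ {n} (λ _ → c) ≡ n * c
Σᵥ-const zero    c = refl
Σᵥ-const (suc n) c = cong (_+_ c) (Σᵥ-const n c)

≤-foldr-⊔ : ∀ {n} (d : Fin n → ℕ) v → d v ≤ foldr _⊔_ 0 d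
≤-foldr-⊔ d zero    = m≤m⊔n (d zero) _
≤-foldr-⊔ d (suc v) = ≤-trans (≤-foldr-⊔ (d ∘ suc) v) (m≤n⊔m (d zero) _)

anyV⁺ : ∀ {n} (p : Fin n → Bool) v → p v ≡ true → anyV p ≡ true
anyV⁺ p zero    pv rewrite pv = refl
anyV⁺ p (suc v) pv with p zero
... | true  = refl
... | false = anyV⁺ (p ∘ suc) v pv

anyV⁻ : ∀ {n} (p : Fin n → Bool) → anyV p ≡ true → ∃ λ v → p v ≡ true
anyV⁻ {suc n} p any with p zero in p0
... | true  = zero , p0
... | false with anyV⁻ (p ∘ suc) any
...   | v , pv = suc v , pv

∧-true⁻ : ∀ {x y} → x ∧ y ≡ true → x ≡ true × y ≡ true
∧-true⁻ {true} {true} refl = refl , refl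

indicator≤1 : ∀ b → (if b then 1 else 0) ≤ 1
indicator≤1 true  = ≤-refl
indicator≤1 false = z≤n

if-mono-≤ : ∀ b {x y : ℕ} → (b ≡ true → x ≤ y) →
            (if b then x else 0) ≤ (if b then y else 0)
if-mono-≤ true  x≤y = x≤y refl
if-mono-≤ false _   = z≤n

*-if-zero : ∀ c b x → c * (if b then x else 0) ≡ (if b then c * x else 0)
*-if-zero c b x = trans (if-float (c *_) b) (if-cong-else b (*-zeroʳ c))

ceilDivSuc-least : ∀ a b w → a ≤ w * suc b → ceilDivSuc a b ≤ w
ceilDivSuc-least a b w a≤ = ≤-pred (m<n*o⇒m/o<n (s≤s (begin
  a + b             ≤⟨ +-monoˡ-≤ b a≤ ⟩
  w * suc b + b     ≡⟨ +-comm (w * suc b) b ⟩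
  b + w * suc b     ∎)))
  where open ≤-Reasoning

-- A vertex that is both a leaf and a support is an end of a K₂ component.
label : (support leaf inD : Bool) → Fin 3
label true  true  _   = 1F
label true  false _   = 2F
label false true  _   = 0F
label false false inD = if inD then 1F else 0F

label-support-nonLeaf : ∀ {s l} d → s ≡ true → l ≡ false → toℕ (label s l d) ≡ 2
label-support-nonLeaf _ refl refl = refl

χ≤label : ∀ s l d → (d ≡ true → l ≡ true → s ≡ true) →
          (if d then 1 else 0) ≤ toℕ (label s l d)
χ≤label true  true  d     _         = indicator≤1 d
χ≤label true  false true  _         = s≤s z≤n
χ≤label true  false false _         = z≤n
χ≤label false true  true  d⇒l⇒s     = case d⇒l⇒s refl refl of λ ()
χ≤label false true  false _         = z≤n
χ≤label false false true  _         = ≤-refl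
χ≤label false false false _         = z≤n

label-weight : ∀ s l d → (l ≡ true → d ≡ true) → (s ≡ true → d ≡ true) →
               toℕ (label s l d) + (if l then 1 else 0) ≡
               (if d then 1 else 0) + (if s then 1 else 0)
label-weight true  true  d     l⇒d _   rewrite l⇒d refl = refl
label-weight true  false d     _   s⇒d rewrite s⇒d refl = refl
label-weight false true  d     l⇒d _   rewrite l⇒d refl = refl
label-weight false false true  _   _   = refl
label-weight false false false _   _   = refl

module _ {n : ℕ} (G : Graph n) where

  adj-sym : ∀ {u v} → adj G u v ≡ true → adj G v u ≡ true
  adj-sym {u} {v} a = trans (Graph.sym G v u) a

  sumN-mono-≤ : ∀ {f g : Fin n → ℕ} v → (∀ u → adj G v u ≡ true → f u ≤ g u) →
                sumN G f v ≤ sumN G g v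
  sumN-mono-≤ v f≤g = Σᵥ-mono-≤ λ u → if-mono-≤ (adj G v u) (f≤g u)

  sumN-scale : ∀ c (f : Fin n → ℕ) v → sumN G (λ u → c * f u) v ≡ c * sumN G f v
  sumN-scale c f v = trans (sum-cong-≗ λ u → sym (*-if-zero c (adj G v u) (f u)))
                           (sym (*-distribˡ-sum c (λ u → if adj G v u then f u else 0)))

  sumN-const : ∀ c v → sumN G (λ _ → c) v ≡ c * deg G v
  sumN-const c v = trans (sum-cong-≗ λ u → if-cong-then (adj G v u) (sym (*-identityʳ c)))
                         (sumN-scale c (λ _ → 1) v)

  sumN-χ≤deg : ∀ D v → sumN G (χ G D) v ≤ deg G v
  sumN-χ≤deg D v = sumN-mono-≤ v λ u _ → indicator≤1 (D u)

  sumN-χ<deg : ∀ D {u v} → adj G v u ≡ true → D u ≡ false → sumN G (χ G D) v < deg G v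
  sumN-χ<deg D {u} {v} a u∉D =
    Σᵥ-mono-< (λ w → if-mono-≤ (adj G v w) λ _ → indicator≤1 (D w)) u at-u
    where
    at-u : (if adj G v u then χ G D u else 0) < (if adj G v u then 1 else 0)
    at-u rewrite a | u∉D = ≤-refl

  Σᵥ-sumN : ∀ (f : Fin n → ℕ) → Σᵥ (sumN G f) ≡ Σᵥ (λ u → f u * deg G u)
  Σᵥ-sumN f = begin
    Σᵥ (λ v → Σᵥ (λ u → if adj G v u then f u else 0))
      ≡⟨ ∑-comm (λ v u → if adj G v u then f u else 0) ⟩
    Σᵥ (λ u → Σᵥ (λ v → if adj G v u then f u else 0))
      ≡⟨ sum-cong-≗ (λ u → sum-cong-≗ λ v → if-cong (Graph.sym G v u)) ⟩
    Σᵥ (λ u → sumN G (λ _ → f u) u)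
      ≡⟨ sum-cong-≗ (λ u → sumN-const (f u) u) ⟩
    Σᵥ (λ u → f u * deg G u)
      ∎
    where open ≡-Reasoning

  deg≤maxDeg : ∀ v → deg G v ≤ maxDeg G
  deg≤maxDeg = ≤-foldr-⊔ (deg G)

  closedNbhdCount-out : ∀ D {v} → D v ≡ false → closedNbhdCount G D v ≡ sumN G (χ G D) v
  closedNbhdCount-out D {v} v∉D = cong (λ b → (if b then 1 else 0) + sumN G (χ G D) v) v∉D

  isLeaf⇒deg≡1 : ∀ {v} → isLeaf G v ≡ true → deg G v ≡ 1
  isLeaf⇒deg≡1 {v} leaf with deg G v
  isLeaf⇒deg≡1 ()   | zero
  isLeaf⇒deg≡1 _    | suc zero = refl
  isLeaf⇒deg≡1 ()   | suc (suc _)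

  adj-leaf⇒isSupport : ∀ {u v} → adj G u v ≡ true → isLeaf G v ≡ true → isSupport G u ≡ true
  adj-leaf⇒isSupport {u} {v} a leaf =
    anyV⁺ (λ w → adj G u w ∧ isLeaf G w) v (cong₂ _∧_ a leaf)

  isSupport⇒adj-leaf : ∀ {v} → isSupport G v ≡ true →
                       ∃ λ u → adj G v u ≡ true × isLeaf G u ≡ true
  isSupport⇒adj-leaf {v} supp with anyV⁻ (λ w → adj G v w ∧ isLeaf G w) supp
  ... | u , a∧leaf = u , ∧-true⁻ a∧leaf

  Is210DF⇒2≤closed : ∀ f → Is210DF G f → ∀ v → 2 ≤ toℕ (f v) + sumN G (toℕ ∘ f) v
  Is210DF⇒2≤closed f isDF v with f v | isDF v
  ... | 0F | (f[N]≥2 , _) = f[N]≥2 refl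
  ... | 1F | (_ , f[N]≥1) = s≤s (f[N]≥1 refl)
  ... | 2F | _            = s≤s (s≤s z≤n)

  Is210DF⇒2n≤weight*[1+Δ] : ∀ f → Is210DF G f →
                            2 * n ≤ weight G (toℕ ∘ f) * suc (maxDeg G)
  Is210DF⇒2n≤weight*[1+Δ] f isDF = begin
    2 * n                                 ≡⟨ *-comm 2 n ⟩
    n * 2                                 ≡⟨ Σᵥ-const n 2 ⟨
    Σᵥ {n} (λ _ → 2)                      ≤⟨ Σᵥ-mono-≤ (Is210DF⇒2≤closed f isDF) ⟩
    Σᵥ (λ v → F v + sumN G F v)           ≡⟨ ∑-distrib-+ F (sumN G F) ⟩
    w + Σᵥ (sumN G F)                     ≡⟨ cong (_+_ w) (Σᵥ-sumN F) ⟩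
    w + Σᵥ (λ u → F u * deg G u)          ≤⟨ +-monoʳ-≤ w (Σᵥ-mono-≤ F*deg≤F*Δ) ⟩
    w + Σᵥ (λ u → F u * Δ)                ≡⟨ cong (_+_ w) (*-distribʳ-sum Δ F) ⟨
    w + w * Δ                             ≡⟨ *-suc w Δ ⟨
    w * suc Δ                             ∎
    where
    open ≤-Reasoning
    F = toℕ ∘ f
    w = weight G F
    Δ = maxDeg G
    F*deg≤F*Δ : ∀ u → F u * deg G u ≤ F u * Δ
    F*deg≤F*Δ u = *-monoʳ-≤ (F u) (deg≤maxDeg u)

  twice : (Fin n → Bool) → Fin n → Fin 3
  twice D v = if D v then 2F else 0F

  toℕ-twice : ∀ D v → toℕ (twice D v) ≡ 2 * χ G D v
  toℕ-twice D v with D v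
  ... | true  = refl
  ... | false = refl

  weight-twice : ∀ D → weight G (toℕ ∘ twice D) ≡ 2 * count D
  weight-twice D = trans (sum-cong-≗ (toℕ-twice D)) (sym (*-distribˡ-sum 2 (χ G D)))

  dominating⇒twice-Is210DF : ∀ D → IsDominating G D → Is210DF G (twice D)
  dominating⇒twice-Is210DF D dom v with D v in v∈D?
  ... | true  = (λ ()) , (λ ())
  ... | false = (λ _ → begin
    2                             ≤⟨ *-monoʳ-≤ 2 D∩N[v]≢∅ ⟩
    2 * sumN G (χ G D) v          ≡⟨ sumN-scale 2 (χ G D) v ⟨
    sumN G (λ u → 2 * χ G D u) v  ≡⟨ sum-cong-≗ (λ u → if-cong-then (adj G v u) (sym (toℕ-twice D u))) ⟩
    sumN G (toℕ ∘ twice D) v      ∎) , (λ ())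
    where
    open ≤-Reasoning
    D∩N[v]≢∅ : 1 ≤ sumN G (χ G D) v
    D∩N[v]≢∅ = ≤-trans (dom v) (≤-reflexive (closedNbhdCount-out D v∈D?))

  nonSupport-adj⇒nonLeaf : ∀ {u v} → isSupport G v ≡ false → adj G v u ≡ true →
                           isLeaf G u ≡ false
  nonSupport-adj⇒nonLeaf v∉S a =
    ¬-not λ u∈L → case trans (sym (adj-leaf⇒isSupport a u∈L)) v∉S of λ ()

  module _ (D : Fin n → Bool) (dd : IsDoubleDominating G D) where

    doubleDom⇒1≤sumN : ∀ v → 1 ≤ sumN G (χ G D) v
    doubleDom⇒1≤sumN v = +-cancelˡ-≤ 1 1 _ (≤-trans (dd v) (+-monoˡ-≤ _ (indicator≤1 (D v))))

    doubleDom⇒2≤sumN : ∀ {v} → D v ≡ false → 2 ≤ sumN G (χ G D) v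
    doubleDom⇒2≤sumN {v} v∉D = ≤-trans (dd v) (≤-reflexive (closedNbhdCount-out D v∉D))

    doubleDom-leaf∈ : ∀ {v} → isLeaf G v ≡ true → D v ≡ true
    doubleDom-leaf∈ {v} leaf = ¬-not λ v∉D → <-irrefl refl (begin
      2                    ≤⟨ doubleDom⇒2≤sumN v∉D ⟩
      sumN G (χ G D) v     ≤⟨ sumN-χ≤deg D v ⟩
      deg G v              ≡⟨ isLeaf⇒deg≡1 leaf ⟩
      1                    ∎)
      where open ≤-Reasoning

    doubleDom-support∈ : ∀ {v} → isSupport G v ≡ true → D v ≡ true
    doubleDom-support∈ {v} supp with isSupport⇒adj-leaf supp
    ... | u , a , leaf = ¬-not λ v∉D → <-irrefl refl (begin-strict
      1                    ≤⟨ doubleDom⇒1≤sumN u ⟩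
      sumN G (χ G D) u     <⟨ sumN-χ<deg D (adj-sym a) v∉D ⟩
      deg G u              ≡⟨ isLeaf⇒deg≡1 leaf ⟩
      1                    ∎)
      where open ≤-Reasoning

    doubleDomTo210 : Fin n → Fin 3
    doubleDomTo210 v = label (isSupport G v) (isLeaf G v) (D v)

    sumN-χ≤sumN-doubleDomTo210 : ∀ v → isLeaf G v ≡ true ⊎ isSupport G v ≡ false →
                                  sumN G (χ G D) v ≤ sumN G (toℕ ∘ doubleDomTo210) v
    sumN-χ≤sumN-doubleDomTo210 v leaf⊎nonSupport =
      sumN-mono-≤ v λ u a → χ≤label _ _ (D u) λ _ → leafNbr⇒isSupport leaf⊎nonSupport a
      where
      leafNbr⇒isSupport : ∀ {u} → isLeaf G v ≡ true ⊎ isSupport G v ≡ false →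
                          adj G v u ≡ true → isLeaf G u ≡ true → isSupport G u ≡ true
      leafNbr⇒isSupport (inj₁ v∈L) a _    = adj-leaf⇒isSupport (adj-sym a) v∈L
      leafNbr⇒isSupport (inj₂ v∉S) a u∈L =
        case trans (sym u∈L) (nonSupport-adj⇒nonLeaf v∉S a) of λ ()

    doubleDomTo210-Is210DF : Is210DF G doubleDomTo210
    doubleDomTo210-Is210DF v with isSupport G v in v∈S? | isLeaf G v in v∈L? | D v in v∈D?
    ... | true  | true  | _     =
      (λ ()) , λ _ → ≤-trans (doubleDom⇒1≤sumN v) (sumN-χ≤sumN-doubleDomTo210 v (inj₁ v∈L?))
    ... | true  | false | _     = (λ ()) , (λ ())
    ... | false | true  | _     = (λ _ → begin
      2                                  ≡⟨ cong (2 *_) (isLeaf⇒deg≡1 v∈L?) ⟨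
      2 * deg G v                        ≡⟨ sumN-const 2 v ⟨
      sumN G (λ _ → 2) v                 ≤⟨ sumN-mono-≤ v (λ u a → ≤-reflexive (sym (nbr≡2 a))) ⟩
      sumN G (toℕ ∘ doubleDomTo210) v    ∎) , (λ ())
      where
      open ≤-Reasoning
      nbr≡2 : ∀ {u} → adj G v u ≡ true → toℕ (doubleDomTo210 u) ≡ 2
      nbr≡2 a = label-support-nonLeaf (D _) (adj-leaf⇒isSupport (adj-sym a) v∈L?)
                                            (nonSupport-adj⇒nonLeaf v∈S? a)
    ... | false | false | true  =
      (λ ()) , λ _ → ≤-trans (doubleDom⇒1≤sumN v) (sumN-χ≤sumN-doubleDomTo210 v (inj₂ v∈S?))
    ... | false | false | false =
      (λ _ → ≤-trans (doubleDom⇒2≤sumN v∈D?) (sumN-χ≤sumN-doubleDomTo210 v (inj₂ v∈S?))) , (λ ())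

    weight-doubleDomTo210 : weight G (toℕ ∘ doubleDomTo210) + numLeaves G ≡
                            count D + numSupports G
    weight-doubleDomTo210 = begin
      Σᵥ F + Σᵥ (χ G (isLeaf G))
        ≡⟨ ∑-distrib-+ F (χ G (isLeaf G)) ⟨
      Σᵥ (λ v → F v + χ G (isLeaf G) v)
        ≡⟨ sum-cong-≗ (λ v → label-weight _ _ (D v) doubleDom-leaf∈ doubleDom-support∈) ⟩
      Σᵥ (λ v → χ G D v + χ G (isSupport G) v)
        ≡⟨ ∑-distrib-+ (χ G D) (χ G (isSupport G)) ⟩
      count D + numSupports G
        ∎
      where
      open ≡-Reasoning
      F = toℕ ∘ doubleDomTo210

m+n≡o+p⇒m≡o-n+p : ∀ {m n o p} → m + n ≡ o + p → + m ≡ + o - + n +ℤ + p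
m+n≡o+p⇒m≡o-n+p {m} {n} {o} {p} eq = sym (begin
  + o - + n +ℤ + p      ≡⟨ sub-add-comm (+ o) (+ n) (+ p) ⟩
  + o +ℤ + p - + n      ≡⟨ cong (_- + n) (sym (pos-+ o p)) ⟩
  + (o + p) - + n       ≡⟨ cong (λ x → + x - + n) (sym eq) ⟩
  + (m + n) - + n       ≡⟨ cong (_- + n) (pos-+ m n) ⟩
  + m +ℤ + n - + n      ≡⟨ add-sub-cancel (+ m) (+ n) ⟩
  + m                   ∎)
  where
  open ≡-Reasoning
  sub-add-comm : ∀ (x y z : ℤ) → x - y +ℤ z ≡ x +ℤ z - y
  sub-add-comm = solve-∀
  add-sub-cancel : ∀ (x y : ℤ) → x +ℤ y - y ≡ x
  add-sub-cancel = solve-∀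

theorem3p33 : ∀ {n : ℕ} (G : Graph n) → NoIsolated G →
    ∀ (g210 gdd g : ℕ) →
    Is210DomNumber G g210 → IsDoubleDomNumber G gdd → IsDomNumber G g →
    (ceilDivSuc (2 * n) (maxDeg G) ≤ g210) ×
    ((+ g210) ≤ℤ (((+ gdd) - (+ numLeaves G) +ℤ (+ numSupports G)) ⊓ (+ (2 * g))))
theorem3p33 {n} G _ g210 gdd g ((f , f-210 , wf≡g210) , g210-least)
                               ((D₂ , D₂-dd , |D₂|≡gdd) , _) ((D , D-dom , |D|≡g) , _) =
  subst (ceilDivSuc (2 * n) (maxDeg G) ≤_) wf≡g210
    (ceilDivSuc-least (2 * n) (maxDeg G) _ (Is210DF⇒2n≤weight*[1+Δ] G f f-210)) ,
  ℤ-⊓-glb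
    (subst ((+ g210) ≤ℤ_) (m+n≡o+p⇒m≡o-n+p weight-balance)
      (+≤+ (g210-least _ (doubleDomTo210-Is210DF G D₂ D₂-dd))))
    (+≤+ (subst (g210 ≤_) (trans (weight-twice G D) (cong (2 *_) |D|≡g))
      (g210-least _ (dominating⇒twice-Is210DF G D D-dom))))
  where
  weight-balance : weight G (toℕ ∘ doubleDomTo210 G D₂ D₂-dd) + numLeaves G ≡
                   gdd + numSupports G
  weight-balance = trans (weight-doubleDomTo210 G D₂ D₂-dd)
                         (cong (_+ numSupports G) |D₂|≡gdd)
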